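{- If $\lim_{n\to\infty}|\mathcal{S}_{n-1}|/|\mathcal{S}_n|=0$, then $\lim_{n\to\infty}|\mathcal{B}_n|/|\mathcal{S}_n|=1$.
   Context: $\mathcal{S}_n$ is the set of unlabeled (up to isomorphism) split graphs on $n$ vertices, where a split graph is a finite simple graph whose vertex set partitions as $K\cup S$ with $K$ a clique and $S$ a stable set. A split graph $G$ is balanced if it has such a partition with $|K|=\omega(G)$ (clique number) and $|S|=\alpha(G)$ (independence number); $\mathcal{B}_n$ is the set of unlabeled balanced split graphs on $n$ vertices. -}

module Defs where

open import Data.Bool using (Bool; true; false)
open import Data.Nat using (ℕ; zero; suc; _*_; _<_; _≤_; _≥_; ∣_-_∣)
open import Data.Fin using (Fin)
open import Data.Fin.Subset using (Subset; _∈_; ∁; ∣_∣)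
open import Data.Fin.Permutation using (Permutation′; _⟨$⟩ʳ_)
open import Data.Product using (Σ; ∃; _×_)
open import Relation.Binary.PropositionalEquality using (_≡_; _≢_)
open import Relation.Nullary using (¬_)

record Graph (n : ℕ) : Set where
  field
    adj    : Fin n → Fin n → Bool
    sym    : ∀ i j → adj i j ≡ adj j i
    irrefl : ∀ i → adj i i ≡ false
open Graph public

Iso : ∀ {n} → Graph n → Graph n → Set
Iso {n} G H = Σ (Permutation′ n) λ π →
  ∀ i j → adj H (π ⟨$⟩ʳ i) (π ⟨$⟩ʳ j) ≡ adj G i j

IsClique : ∀ {n} → Graph n → Subset n → Set
IsClique G K = ∀ i j → i ∈ K → j ∈ K → i ≢ j → adj G i j ≡ true

IsStable : ∀ {n} → Graph n → Subset n → Set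
IsStable G S = ∀ i j → i ∈ S → j ∈ S → adj G i j ≡ false

IsSplit : ∀ {n} → Graph n → Set
IsSplit {n} G = ∃ λ (K : Subset n) → IsClique G K × IsStable G (∁ K)

-- Balanced split graph: a split partition with |K| = ω(G) and |S| = α(G),
-- i.e. |K| is at least the size of every clique, |S| at least the size
-- of every stable set.
IsBalanced : ∀ {n} → Graph n → Set
IsBalanced {n} G = ∃ λ (K : Subset n) →
  IsClique G K × IsStable G (∁ K) ×
  (∀ K′ → IsClique G K′ → ∣ K′ ∣ ≤ ∣ K ∣) ×
  (∀ S′ → IsStable G S′ → ∣ S′ ∣ ≤ ∣ ∁ K ∣)

-- "There are exactly k isomorphism classes of n-vertex graphs with
-- property P": a complete, irredundant list of k representatives.
NumClasses : (n : ℕ) → (P : Graph n → Set) → ℕ → Set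
NumClasses n P k = Σ (Fin k → Graph n) λ rep →
  (∀ i → P (rep i)) ×
  (∀ i j → i ≢ j → ¬ Iso (rep i) (rep j)) ×
  (∀ (G : Graph n) → P G → ∃ λ i → Iso G (rep i))

-- lim_{n→∞} a(n) / c(n) = 0  (ε = p/q with p, q > 0)
RatioTendsToZero : (ℕ → ℕ) → (ℕ → ℕ) → Set
RatioTendsToZero a c = ∀ p q → 0 < p → 0 < q →
  ∃ λ N → ∀ n → n ≥ N → q * a n < p * c n

-- lim_{n→∞} a(n) / c(n) = 1, i.e. |a(n)/c(n) - 1| < ε eventually
RatioTendsToOne : (ℕ → ℕ) → (ℕ → ℕ) → Set
RatioTendsToOne a c = ∀ p q → 0 < p → 0 < q →
  ∃ λ N → ∀ n → n ≥ N → q * ∣ a n - c n ∣ < p * c n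

module Submission where

-- Call u a swing vertex of G if G − u is split with clique side N(u).
-- The proof rests on two structural facts about split graphs.
--  (1) A split graph without swing vertex is balanced
--      (balanced-unless-swing): a clique larger than the clique side K,
--      or a stable set larger than its complement, yields a vertex whose
--      neighbourhood is exactly K or K minus itself, i.e. a swing vertex.
--  (2) A graph with swing vertex u is determined up to isomorphism by
--      G − u and one bit, whether the clique side N(u) can be enlarged
--      inside G − u (swing-reconstruction).  This follows because two
--      split partitions of a graph with the same bit are exchanged by an
--      automorphism, namely a swap of twins (splitLabellings-conjugate).
-- Encoding split graphs accordingly gives b(n) ≤ s(n) and
-- s(n+1) ≤ b(n+1) + 2·s(n) (classes-bound), so 0 ≤ s(n+1) − b(n+1) ≤
-- 2·s(n), and the hypothesis finishes the argument.

open import Defs hiding (sym)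
open import Data.Bool using (Bool; true; false; not; T)
open import Data.Bool.Properties using (not-¬; ¬-not) renaming (_≟_ to _≟ᵇ_)
open import Data.Nat using (ℕ; suc; _+_; _*_; _≤_; _<_; _≥_; ∣_-_∣; s≤s)
open import Data.Nat.Properties
  using (≤-trans; ≤-<-trans; m≤m+n; +-monoʳ-≤; +-cancelʳ-≤; +-suc;
         *-monoʳ-≤; *-distribˡ-+; *-distribʳ-+; m≤n⇒∣m-n∣≡n∸m; m≤n+o⇒m∸n≤o; module ≤-Reasoning)
open import Data.Fin using (Fin; zero; suc; _≟_; punchIn; join; splitAt)
open import Data.Fin.Properties
  using (any?; all?; punchInᵢ≢i; punchIn-injective; splitAt-join; injective⇒≤)
open import Data.Fin.Permutation
  using (Permutation′; _⟨$⟩ʳ_; _⟨$⟩ˡ_; inverseˡ; inverseʳ; id; flip; _∘ₚ_; transpose; lift₀; insert; insert-punchIn)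
open import Data.Fin.Subset using (Subset; _∈_; _∉_; ∁; ∣_∣; _∩_; ⁅_⁆; _⊆_; inside; outside)
open import Data.Fin.Subset.Properties
  using (_∈?_; x∉p⇒x∈∁p; x∉∁p⇒x∈p; x∈∁p⇒x∉p; p⊆q⇒∣p∣≤∣q∣; ∣⁅x⁆∣≡1; x∈⁅x⁆; x∈⁅y⁆⇒x≡y; x∈p∩q⁺; x∈p∩q⁻)
open import Data.Vec using ([]; _∷_; tabulate)
open import Data.Vec.Properties using ([]=⇒lookup; lookup⇒[]=; lookup∘tabulate)
open import Data.Product using (Σ; ∃; _×_; _,_; proj₁; proj₂)
open import Data.Sum using (_⊎_; inj₁; inj₂; map₂)
open import Data.Sum.Properties using (inj₂-injective)
open import Data.Empty using (⊥; ⊥-elim)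
open import Relation.Binary.PropositionalEquality
  using (_≡_; _≢_; refl; sym; trans; cong; cong₂; subst; module ≡-Reasoning)
open import Relation.Nullary using (¬_; Dec; yes; no)
open import Relation.Nullary.Decidable using (_×-dec_; ¬?; _→-dec_; dec-true; dec-false; isYes; toWitness; fromWitness)

private
  variable
    n m : ℕ

-- Graph isomorphism as a record, so that both graphs can be inferred from
-- an isomorphism (with the Σ-type Iso they cannot).
record _≅_ (G H : Graph n) : Set where
  constructor mk≅
  field
    perm      : Permutation′ n
    preserves : ∀ i j → adj H (perm ⟨$⟩ʳ i) (perm ⟨$⟩ʳ j) ≡ adj G i j
open _≅_

≅⇒Iso : {G H : Graph n} → G ≅ H → Iso G H
≅⇒Iso (mk≅ π p) = π , p

Iso⇒≅ : {G H : Graph n} → Iso G H → G ≅ H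
Iso⇒≅ (π , p) = mk≅ π p

≅-refl : {G : Graph n} → G ≅ G
≅-refl = mk≅ id (λ i j → refl)

≅-sym : {G H : Graph n} → G ≅ H → H ≅ G
≅-sym {H = H} (mk≅ π p) = mk≅ (flip π) λ i j →
  trans (sym (p (π ⟨$⟩ˡ i) (π ⟨$⟩ˡ j))) (cong₂ (adj H) (inverseʳ π) (inverseʳ π))

≅-trans : {G H L : Graph n} → G ≅ H → H ≅ L → G ≅ L
≅-trans (mk≅ π p) (mk≅ ρ q) = mk≅ (π ∘ₚ ρ) λ i j → trans (q _ _) (p i j)

Carries : {G H : Graph n} → G ≅ H → (Fin n → Bool) → (Fin n → Bool) → Set
Carries σ t t′ = ∀ i → t′ (perm σ ⟨$⟩ʳ i) ≡ t i

carries-image : {G H : Graph n} (σ : G ≅ H) (t : Fin n → Bool) →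
                Carries σ t (λ k → t (perm σ ⟨$⟩ˡ k))
carries-image σ t i = cong t (inverseˡ (perm σ))

carries-sym : {G H : Graph n} (σ : G ≅ H) {t t′ : Fin n → Bool} →
              Carries σ t t′ → Carries (≅-sym σ) t′ t
carries-sym σ {t} {t′} c k = begin
  t (perm σ ⟨$⟩ˡ k)                     ≡⟨ sym (c _) ⟩
  t′ (perm σ ⟨$⟩ʳ (perm σ ⟨$⟩ˡ k))      ≡⟨ cong t′ (inverseʳ (perm σ)) ⟩
  t′ k                                  ∎
  where open ≡-Reasoning

carries-trans : {G H L : Graph n} (σ : G ≅ H) (τ : H ≅ L) {t t′ t″ : Fin n → Bool} →
                Carries σ t t′ → Carries τ t′ t″ → Carries (≅-trans σ τ) t t″
carries-trans σ τ c d i = trans (d _) (c i)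

delete : Graph (suc m) → Fin (suc m) → Graph m
delete G u = record
  { adj    = λ i j → adj G (punchIn u i) (punchIn u j)
  ; sym    = λ i j → Graph.sym G _ _
  ; irrefl = λ i → irrefl G _
  }

neighbours : Graph (suc m) → Fin (suc m) → Fin m → Bool
neighbours G u j = adj G u (punchIn u j)

attachAdj : Graph m → (Fin m → Bool) → Fin (suc m) → Fin (suc m) → Bool
attachAdj H t zero    zero    = false
attachAdj H t zero    (suc j) = t j
attachAdj H t (suc i) zero    = t i
attachAdj H t (suc i) (suc j) = adj H i j

attach : Graph m → (Fin m → Bool) → Graph (suc m)
attach H t = record { adj = attachAdj H t ; sym = symmetric ; irrefl = irreflexive }
  where
  symmetric : ∀ i j → attachAdj H t i j ≡ attachAdj H t j i
  symmetric zero    zero    = refl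
  symmetric zero    (suc j) = refl
  symmetric (suc i) zero    = refl
  symmetric (suc i) (suc j) = Graph.sym H i j

  irreflexive : ∀ i → attachAdj H t i i ≡ false
  irreflexive zero    = refl
  irreflexive (suc i) = irrefl H i

attach-delete : {m : ℕ} (G : Graph (suc m)) (u : Fin (suc m)) →
                attach (delete G u) (neighbours G u) ≅ G
attach-delete {m} G u = mk≅ π preserves′
  where
  π : Permutation′ (suc m)
  π = insert zero u id
  π-punchIn : ∀ k → π ⟨$⟩ʳ suc k ≡ punchIn u k
  π-punchIn k = insert-punchIn zero u id k

  preserves′ : ∀ i j → adj G (π ⟨$⟩ʳ i) (π ⟨$⟩ʳ j) ≡ attachAdj (delete G u) (neighbours G u) i j
  preserves′ zero    zero    = irrefl G u
  preserves′ zero    (suc j) rewrite π-punchIn j = refl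
  preserves′ (suc i) zero    rewrite π-punchIn i = Graph.sym G _ _
  preserves′ (suc i) (suc j) rewrite π-punchIn i | π-punchIn j = refl

attach-cong : {H H′ : Graph m} (σ : H ≅ H′) {t t′ : Fin m → Bool} →
              Carries σ t t′ → attach H t ≅ attach H′ t′
attach-cong {H = H} {H′} (mk≅ π p) {t} {t′} c = mk≅ (lift₀ π) preserves′
  where
  preserves′ : ∀ i j → attachAdj H′ t′ (lift₀ π ⟨$⟩ʳ i) (lift₀ π ⟨$⟩ʳ j) ≡ attachAdj H t i j
  preserves′ zero    zero    = refl
  preserves′ zero    (suc j) = c j
  preserves′ (suc i) zero    = c i
  preserves′ (suc i) (suc j) = p i j

IsSplitLabelling : Graph m → (Fin m → Bool) → Set
IsSplitLabelling H t =
  (∀ i j → t i ≡ true → t j ≡ true → i ≢ j → adj H i j ≡ true) ×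
  (∀ i j → t i ≡ false → t j ≡ false → adj H i j ≡ false)

isSplitLabelling? : (H : Graph m) (t : Fin m → Bool) → Dec (IsSplitLabelling H t)
isSplitLabelling? H t =
  all? (λ i → all? λ j → (t i ≟ᵇ true) →-dec ((t j ≟ᵇ true) →-dec (¬? (i ≟ j) →-dec (adj H i j ≟ᵇ true))))
  ×-dec
  all? (λ i → all? λ j → (t i ≟ᵇ false) →-dec ((t j ≟ᵇ false) →-dec (adj H i j ≟ᵇ false)))

Enlargeable : Graph m → (Fin m → Bool) → Set
Enlargeable H t = ∃ λ y → t y ≡ false × (∀ z → t z ≡ true → adj H y z ≡ true)

enlargeable? : (H : Graph m) (t : Fin m → Bool) → Dec (Enlargeable H t)
enlargeable? H t =
  any? λ y → (t y ≟ᵇ false) ×-dec all? (λ z → (t z ≟ᵇ true) →-dec (adj H y z ≟ᵇ true))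

splitLabelling-pullback : {H H′ : Graph m} (σ : H ≅ H′) {t t′ : Fin m → Bool} →
  Carries σ t t′ → IsSplitLabelling H′ t′ → IsSplitLabelling H t
splitLabelling-pullback (mk≅ π p) c (clique , stable) =
    (λ i j ti tj i≢j → trans (sym (p i j))
       (clique _ _ (trans (c i) ti) (trans (c j) tj) (λ e → i≢j (π-injective e))))
  , (λ i j ti tj → trans (sym (p i j)) (stable _ _ (trans (c i) ti) (trans (c j) tj)))
  where
  π-injective : ∀ {i j} → π ⟨$⟩ʳ i ≡ π ⟨$⟩ʳ j → i ≡ j
  π-injective {i} {j} e = trans (sym (inverseˡ π)) (trans (cong (π ⟨$⟩ˡ_) e) (inverseˡ π))

enlargeable-push : {m : ℕ} {H H′ : Graph m} (σ : H ≅ H′) {t t′ : Fin m → Bool} →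
  Carries σ t t′ → Enlargeable H t → Enlargeable H′ t′
enlargeable-push {m} {H = H} {H′} σ {t} {t′} c (y , ty , dominates) =
  π ⟨$⟩ʳ y , trans (c y) ty , dominates′
  where
  π : Permutation′ m
  π = perm σ
  dominates′ : ∀ z → t′ z ≡ true → adj H′ (π ⟨$⟩ʳ y) z ≡ true
  dominates′ z t′z = begin
    adj H′ (π ⟨$⟩ʳ y) z                     ≡⟨ preserves (≅-sym σ) (π ⟨$⟩ʳ y) z ⟨
    adj H (π ⟨$⟩ˡ (π ⟨$⟩ʳ y)) (π ⟨$⟩ˡ z)   ≡⟨ cong (λ w → adj H w (π ⟨$⟩ˡ z)) (inverseˡ π) ⟩
    adj H y (π ⟨$⟩ˡ z)                      ≡⟨ dominates _ (trans (carries-sym σ c z) t′z) ⟩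
    true                                    ∎
    where open ≡-Reasoning

Twins : Graph m → Fin m → Fin m → Set
Twins H x y = ∀ z → z ≢ x → z ≢ y → adj H x z ≡ adj H y z

data Position {m} (x y : Fin m) : Fin m → Set where
  at-x  : Position x y x
  at-y  : Position x y y
  other : ∀ z → z ≢ x → z ≢ y → Position x y z

position : (x y z : Fin m) → Position x y z
position x y z with z ≟ x | z ≟ y
... | yes refl | _        = at-x
... | no _     | yes refl = at-y
... | no z≢x   | no z≢y   = other z z≢x z≢y

module _ (x y : Fin m) where

  transpose-x : transpose x y ⟨$⟩ʳ x ≡ y
  transpose-x rewrite dec-true (x ≟ x) refl = refl

  transpose-y : x ≢ y → transpose x y ⟨$⟩ʳ y ≡ x
  transpose-y x≢y rewrite dec-false (y ≟ x) (λ e → x≢y (sym e)) | dec-true (y ≟ y) refl = refl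

  transpose-other : ∀ z → z ≢ x → z ≢ y → transpose x y ⟨$⟩ʳ z ≡ z
  transpose-other z z≢x z≢y rewrite dec-false (z ≟ x) z≢x | dec-false (z ≟ y) z≢y = refl

swap-twins : (H : Graph m) {x y : Fin m} → x ≢ y → Twins H x y → H ≅ H
swap-twins H {x} {y} x≢y twins = mk≅ (transpose x y) swapped
  where
  τx : transpose x y ⟨$⟩ʳ x ≡ y
  τx = transpose-x x y
  τy : transpose x y ⟨$⟩ʳ y ≡ x
  τy = transpose-y x y x≢y
  τo : ∀ z → z ≢ x → z ≢ y → transpose x y ⟨$⟩ʳ z ≡ z
  τo = transpose-other x y
  swapped : ∀ i j → adj H (transpose x y ⟨$⟩ʳ i) (transpose x y ⟨$⟩ʳ j) ≡ adj H i j
  swapped i j with position x y i | position x y j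
  ... | at-x        | at-x        rewrite τx = trans (irrefl H y) (sym (irrefl H x))
  ... | at-x        | at-y        rewrite τx | τy = Graph.sym H y x
  ... | at-x        | other z a b rewrite τx | τo z a b = sym (twins z a b)
  ... | at-y        | at-x        rewrite τx | τy = Graph.sym H x y
  ... | at-y        | at-y        rewrite τy = trans (irrefl H x) (sym (irrefl H y))
  ... | at-y        | other z a b rewrite τy | τo z a b = twins z a b
  ... | other z a b | at-x        rewrite τx | τo z a b =
    trans (Graph.sym H z y) (trans (sym (twins z a b)) (Graph.sym H x z))
  ... | other z a b | at-y        rewrite τy | τo z a b =
    trans (Graph.sym H z x) (trans (twins z a b) (Graph.sym H y z))
  ... | other z a b | other w c d rewrite τo z a b | τo w c d = refl

true≢false : true ≢ false
true≢false ()

bool-agree : {b b′ : Bool} → (b ≡ true → b′ ≡ false → ⊥) → (b′ ≡ true → b ≡ false → ⊥) → b′ ≡ b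
bool-agree {true}  {true}  _    _    = refl
bool-agree {false} {false} _    _    = refl
bool-agree {true}  {false} drop _    = ⊥-elim (drop refl refl)
bool-agree {false} {true}  _    gain = ⊥-elim (gain refl refl)

-- At most one vertex passes from the clique side of t to the stable side
-- of t′: two such vertices would be adjacent (clique of t) and
-- non-adjacent (stable set of t′) at once.
crossing-unique : (H : Graph m) {t t′ : Fin m → Bool} →
  IsSplitLabelling H t → IsSplitLabelling H t′ →
  ∀ {x z} → t x ≡ true → t′ x ≡ false → t z ≡ true → t′ z ≡ false → z ≡ x
crossing-unique H (clique , _) (_ , stable′) {x} {z} tx t′x tz t′z with z ≟ x
... | yes z≡x = z≡x
... | no z≢x  = ⊥-elim (true≢false (trans (sym (clique z x tz tx z≢x)) (stable′ z x t′z t′x)))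

shrinking-changes-enlargeability : (H : Graph m) {t t′ : Fin m → Bool} →
  IsSplitLabelling H t → IsSplitLabelling H t′ →
  ∀ {x} → t x ≡ true → t′ x ≡ false → (∀ y → t′ y ≡ true → t y ≡ true) →
  Enlargeable H t′ × ¬ Enlargeable H t
shrinking-changes-enlargeability H {t} {t′} (clique , _) (_ , stable′) {x} tx t′x t′⊆t =
  (x , t′x , λ z t′z → clique x z tx (t′⊆t z t′z) (x≢ z t′z)) , not-enlargeable
  where
  x≢ : ∀ z → t′ z ≡ true → x ≢ z
  x≢ z t′z x≡z = true≢false (trans (sym t′z) (trans (cong t′ (sym x≡z)) t′x))

  not-enlargeable : ¬ Enlargeable H t
  not-enlargeable (y , ty , dominates) =
    true≢false (trans (sym (dominates x tx)) (stable′ y x t′y t′x))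
    where
    t′y : t′ y ≡ false
    t′y = ¬-not (λ t′y → true≢false (trans (sym (t′⊆t y t′y)) ty))

-- Two split labellings of H with the same enlargeability are conjugate
-- under an automorphism of H: either they coincide, or they differ by
-- exchanging one vertex x of the first clique side with one vertex y of
-- the second, and then x and y are twins.
splitLabellings-conjugate : (H : Graph m) {t t′ : Fin m → Bool} →
  IsSplitLabelling H t → IsSplitLabelling H t′ →
  (Enlargeable H t → Enlargeable H t′) → (Enlargeable H t′ → Enlargeable H t) →
  Σ (H ≅ H) λ τ → Carries τ t t′
splitLabellings-conjugate H {t} {t′} split split′ forth back
  with any? (λ x → (t x ≟ᵇ true) ×-dec (t′ x ≟ᵇ false))
     | any? (λ y → (t′ y ≟ᵇ true) ×-dec (t y ≟ᵇ false))
... | no noDrop | no noGain =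
  ≅-refl , λ i → bool-agree (λ a b → noDrop (i , a , b)) (λ a b → noGain (i , a , b))
... | yes (x , tx , t′x) | no noGain =
  let (enlargeable′ , ¬enlargeable) = shrinking-changes-enlargeability H split split′ tx t′x
                                        (λ y t′y → ¬-not (λ ty → noGain (y , t′y , ty)))
  in ⊥-elim (¬enlargeable (back enlargeable′))
... | no noDrop | yes (y , t′y , ty) =
  let (enlargeable , ¬enlargeable′) = shrinking-changes-enlargeability H split′ split t′y ty
                                        (λ x tx → ¬-not (λ t′x → noDrop (x , tx , t′x)))
  in ⊥-elim (¬enlargeable′ (forth enlargeable))
... | yes (x , tx , t′x) | yes (y , t′y , ty) = swap-twins H x≢y twins , carried
  where
  x≢y : x ≢ y
  x≢y x≡y = true≢false (trans (sym tx) (trans (cong t x≡y) ty))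

  agree-elsewhere : ∀ z → z ≢ x → z ≢ y → t′ z ≡ t z
  agree-elsewhere z z≢x z≢y = bool-agree
    (λ tz t′z → z≢x (crossing-unique H split split′ tx t′x tz t′z))
    (λ t′z tz → z≢y (crossing-unique H split′ split t′y ty t′z tz))

  twins : Twins H x y
  twins z z≢x z≢y with t z in tz
  ... | true  = trans (proj₁ split x z tx tz (λ e → z≢x (sym e)))
                  (sym (proj₁ split′ y z t′y (trans (agree-elsewhere z z≢x z≢y) tz) (λ e → z≢y (sym e))))
  ... | false = trans (proj₂ split′ x z t′x (trans (agree-elsewhere z z≢x z≢y) tz))
                  (sym (proj₂ split y z ty tz))

  carried : Carries (swap-twins H x≢y twins) t t′
  carried i with position x y i
  ... | at-x        rewrite transpose-x x y = trans t′y (sym tx)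
  ... | at-y        rewrite transpose-y x y x≢y = trans t′x (sym ty)
  ... | other z a b rewrite transpose-other x y z a b = agree-elsewhere z a b

-- Both sides count the elements of p ∪ q.
∣p∣+∣q∖p∣≡∣q∣+∣p∖q∣ : (p q : Subset n) → ∣ p ∣ + ∣ q ∩ ∁ p ∣ ≡ ∣ q ∣ + ∣ p ∩ ∁ q ∣
∣p∣+∣q∖p∣≡∣q∣+∣p∖q∣ []            []            = refl
∣p∣+∣q∖p∣≡∣q∣+∣p∖q∣ (inside ∷ p)  (inside ∷ q)  = cong suc (∣p∣+∣q∖p∣≡∣q∣+∣p∖q∣ p q)
∣p∣+∣q∖p∣≡∣q∣+∣p∖q∣ (inside ∷ p)  (outside ∷ q) =
  trans (cong suc (∣p∣+∣q∖p∣≡∣q∣+∣p∖q∣ p q)) (sym (+-suc ∣ q ∣ ∣ p ∩ ∁ q ∣))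
∣p∣+∣q∖p∣≡∣q∣+∣p∖q∣ (outside ∷ p) (inside ∷ q)  =
  trans (+-suc ∣ p ∣ ∣ q ∩ ∁ p ∣) (cong suc (∣p∣+∣q∖p∣≡∣q∣+∣p∖q∣ p q))
∣p∣+∣q∖p∣≡∣q∣+∣p∖q∣ (outside ∷ p) (outside ∷ q) = ∣p∣+∣q∖p∣≡∣q∣+∣p∖q∣ p q

∣p∣≤∣q∣-by-exchange : (p q : Subset n) → ∣ p ∩ ∁ q ∣ ≤ ∣ q ∩ ∁ p ∣ → ∣ p ∣ ≤ ∣ q ∣
∣p∣≤∣q∣-by-exchange p q p∖q≤q∖p = +-cancelʳ-≤ ∣ q ∩ ∁ p ∣ (∣ p ∣) (∣ q ∣) (begin
  ∣ p ∣ + ∣ q ∩ ∁ p ∣  ≡⟨ ∣p∣+∣q∖p∣≡∣q∣+∣p∖q∣ p q ⟩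
  ∣ q ∣ + ∣ p ∩ ∁ q ∣  ≤⟨ +-monoʳ-≤ ∣ q ∣ p∖q≤q∖p ⟩
  ∣ q ∣ + ∣ q ∩ ∁ p ∣  ∎)
  where open ≤-Reasoning

⊆-of-no-escape : {p q : Subset n} → ¬ (∃ λ v → v ∈ p × v ∉ q) → p ⊆ q
⊆-of-no-escape {q = q} no-escape {v} v∈p with v ∈? q
... | yes v∈q = v∈q
... | no  v∉q = ⊥-elim (no-escape (v , v∈p , v∉q))

Homogeneous : Graph n → Bool → Subset n → Set
Homogeneous G b X = ∀ i j → i ∈ X → j ∈ X → i ≢ j → adj G i j ≡ b

-- Let X be b-homogeneous with (not b)-homogeneous complement.  Then every
-- b-homogeneous set C is at most as large as X, unless some vertex outside
-- X is b-joined to all of X.  (C meets ∁ X in at most one vertex v; if C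
-- misses a vertex of X we exchange, otherwise v is b-joined to X.)
homogeneous-bound : (G : Graph n) (b : Bool) {X C : Subset n} →
  Homogeneous G b X → Homogeneous G (not b) (∁ X) → Homogeneous G b C →
  ∣ C ∣ ≤ ∣ X ∣ ⊎ ∃ λ v → v ∉ X × (∀ i → i ∈ X → adj G v i ≡ b)
homogeneous-bound G b {X} {C} homX hom∁X homC with any? (λ v → (v ∈? C) ×-dec ¬? (v ∈? X))
... | no C⊆X = inj₁ (p⊆q⇒∣p∣≤∣q∣ (⊆-of-no-escape C⊆X))
... | yes (v , v∈C , v∉X) with any? (λ k → (k ∈? X) ×-dec ¬? (k ∈? C))
...   | no X⊆C = inj₂ (v , v∉X , λ i i∈X →
          homC v i v∈C (⊆-of-no-escape X⊆C i∈X) (λ v≡i → v∉X (subst (_∈ X) (sym v≡i) i∈X)))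
...   | yes (k , k∈X , k∉C) = inj₁ (∣p∣≤∣q∣-by-exchange C X (begin
          ∣ C ∩ ∁ X ∣  ≤⟨ p⊆q⇒∣p∣≤∣q∣ C∖X⊆⁅v⁆ ⟩
          ∣ ⁅ v ⁆ ∣    ≡⟨ trans (∣⁅x⁆∣≡1 v) (sym (∣⁅x⁆∣≡1 k)) ⟩
          ∣ ⁅ k ⁆ ∣    ≤⟨ p⊆q⇒∣p∣≤∣q∣ ⁅k⁆⊆X∖C ⟩
          ∣ X ∩ ∁ C ∣  ∎))
  where
  open ≤-Reasoning
  C∖X⊆⁅v⁆ : C ∩ ∁ X ⊆ ⁅ v ⁆
  C∖X⊆⁅v⁆ {u} u∈C∖X with x∈p∩q⁻ C (∁ X) u∈C∖X | u ≟ v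
  ... | _             | yes u≡v = subst (_∈ ⁅ v ⁆) (sym u≡v) (x∈⁅x⁆ v)
  ... | u∈C , u∈∁X    | no u≢v  =
    ⊥-elim (not-¬ (homC u v u∈C v∈C u≢v) (hom∁X u v u∈∁X (x∉p⇒x∈∁p v∉X) u≢v))
  ⁅k⁆⊆X∖C : ⁅ k ⁆ ⊆ X ∩ ∁ C
  ⁅k⁆⊆X∖C {x} x∈⁅k⁆ = subst (_∈ X ∩ ∁ C) (sym (x∈⁅y⁆⇒x≡y k x∈⁅k⁆)) (x∈p∩q⁺ (k∈X , x∉p⇒x∈∁p k∉C))

-- u is a swing vertex when G − u is split with clique side N(u).  Then u
-- may be put on either side of a split partition of G.
IsSwing : Graph (suc m) → Fin (suc m) → Set
IsSwing G u = IsSplitLabelling (delete G u) (neighbours G u)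

swing-of-partition : (G : Graph (suc m)) {K : Subset (suc m)} {v : Fin (suc m)} →
  IsClique G K → IsStable G (∁ K) →
  (∀ i → adj G v i ≡ true → i ∈ K) → (∀ i → i ≢ v → adj G v i ≡ false → i ∈ ∁ K) →
  IsSwing G v
swing-of-partition G {v = v} clique stable neighbour∈K non-neighbour∈∁K =
    (λ i j vi vj i≢j → clique _ _ (neighbour∈K _ vi) (neighbour∈K _ vj) (λ e → i≢j (punchIn-injective v i j e)))
  , (λ i j vi vj → stable _ _ (non-neighbour∈∁K _ (punchInᵢ≢i v i) vi) (non-neighbour∈∁K _ (punchInᵢ≢i v j) vj))

-- Any split partition of a split graph without swing vertices is
-- balanced: a larger clique or stable set would, by homogeneous-bound,
-- produce a swing vertex.
balanced-unless-swing : (G : Graph (suc m)) → IsSplit G → ¬ ∃ (IsSwing G) → IsBalanced G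
balanced-unless-swing G (K , clique , stable) no-swing =
  K , clique , stable , clique-bound , stable-bound
  where
  homK : Homogeneous G true K
  homK = clique

  hom∁K : Homogeneous G false (∁ K)
  hom∁K i j i∈ j∈ _ = stable i j i∈ j∈

  hom∁∁K : Homogeneous G true (∁ (∁ K))
  hom∁∁K i j i∈ j∈ = clique i j (x∉∁p⇒x∈p (x∈∁p⇒x∉p i∈)) (x∉∁p⇒x∈p (x∈∁p⇒x∉p j∈))

  no-swing-at : ∀ v → (∀ i → adj G v i ≡ true → i ∈ K) →
                (∀ i → i ≢ v → adj G v i ≡ false → i ∈ ∁ K) → ⊥
  no-swing-at v neighbour∈K non-neighbour∈∁K =
    no-swing (v , swing-of-partition G clique stable neighbour∈K non-neighbour∈∁K)

  -- A larger clique forces a vertex v ∉ K adjacent to all of K: N(v) = K.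
  clique-bound : ∀ C → IsClique G C → ∣ C ∣ ≤ ∣ K ∣
  clique-bound C cliqueC with homogeneous-bound G true homK hom∁K cliqueC
  ... | inj₁ bound = bound
  ... | inj₂ (v , v∉K , joined) = ⊥-elim (no-swing-at v neighbour∈K non-neighbour∈∁K)
    where
    neighbour∈K : ∀ i → adj G v i ≡ true → i ∈ K
    neighbour∈K i vi with i ∈? K
    ... | yes i∈K = i∈K
    ... | no  i∉K = ⊥-elim (true≢false (trans (sym vi) (stable v i (x∉p⇒x∈∁p v∉K) (x∉p⇒x∈∁p i∉K))))
    non-neighbour∈∁K : ∀ i → i ≢ v → adj G v i ≡ false → i ∈ ∁ K
    non-neighbour∈∁K i _ vi with i ∈? K
    ... | yes i∈K = ⊥-elim (true≢false (trans (sym (joined i i∈K)) vi))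
    ... | no  i∉K = x∉p⇒x∈∁p i∉K

  -- A larger stable set forces a vertex v ∈ K with no neighbour outside K: N(v) = K − v.
  stable-bound : ∀ S → IsStable G S → ∣ S ∣ ≤ ∣ ∁ K ∣
  stable-bound S stableS with homogeneous-bound G false hom∁K hom∁∁K (λ i j i∈ j∈ _ → stableS i j i∈ j∈)
  ... | inj₁ bound = bound
  ... | inj₂ (v , v∉∁K , disjoint) = ⊥-elim (no-swing-at v neighbour∈K non-neighbour∈∁K)
    where
    neighbour∈K : ∀ i → adj G v i ≡ true → i ∈ K
    neighbour∈K i vi with i ∈? K
    ... | yes i∈K = i∈K
    ... | no  i∉K = ⊥-elim (true≢false (trans (sym vi) (disjoint i (x∉p⇒x∈∁p i∉K))))
    non-neighbour∈∁K : ∀ i → i ≢ v → adj G v i ≡ false → i ∈ ∁ K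
    non-neighbour∈∁K i i≢v vi with i ∈? K
    ... | yes i∈K = ⊥-elim (true≢false (trans (sym (clique v i (x∉∁p⇒x∈p v∉∁K) i∈K (λ e → i≢v (sym e)))) vi))
    ... | no  i∉K = x∉p⇒x∈∁p i∉K

-- A graph with a swing vertex u is determined up to isomorphism by G − u
-- together with whether the clique side N(u) of G − u is enlargeable: the
-- isomorphism of the deletions can be corrected, by
-- splitLabellings-conjugate, to one carrying N(u) to N(u′), and then
-- re-attaching u and u′ gives isomorphic graphs.
swing-reconstruction : {m : ℕ} (G G′ : Graph (suc m)) {u u′ : Fin (suc m)} →
  IsSwing G u → IsSwing G′ u′ → delete G u ≅ delete G′ u′ →
  (Enlargeable (delete G u) (neighbours G u) → Enlargeable (delete G′ u′) (neighbours G′ u′)) →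
  (Enlargeable (delete G′ u′) (neighbours G′ u′) → Enlargeable (delete G u) (neighbours G u)) →
  G ≅ G′
swing-reconstruction {m} G G′ {u} {u′} swing swing′ ρ forth back =
  ≅-trans (≅-sym (attach-delete G u)) (≅-trans (attach-cong κ carried-κ) (attach-delete G′ u′))
  where
  t : Fin m → Bool
  t = neighbours G u

  tρ : Fin m → Bool
  tρ k = t (perm ρ ⟨$⟩ˡ k)

  carried-ρ : Carries ρ t tρ
  carried-ρ = carries-image ρ t

  carried-ρ⁻¹ : Carries (≅-sym ρ) tρ t
  carried-ρ⁻¹ = carries-sym ρ carried-ρ

  conjugate : Σ (delete G′ u′ ≅ delete G′ u′) λ τ → Carries τ tρ (neighbours G′ u′)
  conjugate = splitLabellings-conjugate (delete G′ u′)
    (splitLabelling-pullback (≅-sym ρ) carried-ρ⁻¹ swing) swing′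
    (λ e → forth (enlargeable-push (≅-sym ρ) carried-ρ⁻¹ e))
    (λ e → enlargeable-push ρ carried-ρ (back e))

  κ : delete G u ≅ delete G′ u′
  κ = ≅-trans ρ (proj₁ conjugate)

  carried-κ : Carries κ t (neighbours G′ u′)
  carried-κ = carries-trans ρ (proj₁ conjugate) {t″ = neighbours G′ u′} carried-ρ (proj₂ conjugate)

labelling⇒split : (H : Graph m) {t : Fin m → Bool} → IsSplitLabelling H t → IsSplit H
labelling⇒split H {t} (clique , stable) =
  tabulate t , (λ i j i∈ j∈ → clique i j (labelled i∈) (labelled j∈))
             , (λ i j i∈ j∈ → stable i j (unlabelled i∈) (unlabelled j∈))
  where
  labelled : ∀ {i} → i ∈ tabulate t → t i ≡ true
  labelled {i} i∈ = trans (sym (lookup∘tabulate t i)) ([]=⇒lookup i∈)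

  unlabelled : ∀ {i} → i ∈ ∁ (tabulate t) → t i ≡ false
  unlabelled {i} i∈ = ¬-not λ ti →
    x∈∁p⇒x∉p i∈ (lookup⇒[]= i (tabulate t) (trans (lookup∘tabulate t i) ti))

-- If the n-vertex graphs with property P can be encoded in Fin k so that
-- equal codes force isomorphism, there are at most k isomorphism classes:
-- the code is injective on a list of pairwise non-isomorphic representatives.
classes-bound : {P : Graph n → Set} {c k : ℕ} → NumClasses n P c →
  (code : ∀ G → P G → Fin k) →
  (∀ {G G′} (p : P G) (p′ : P G′) → code G p ≡ code G′ p′ → G ≅ G′) →
  c ≤ k
classes-bound (rep , hasP , distinct , _) code faithful = injective⇒≤ injective
  where
  injective : ∀ {i j} → code (rep i) (hasP i) ≡ code (rep j) (hasP j) → i ≡ j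
  injective {i} {j} e with i ≟ j
  ... | yes i≡j = i≡j
  ... | no  i≢j = ⊥-elim (distinct i j i≢j (≅⇒Iso (faithful (hasP i) (hasP j) e)))

-- There are no more balanced split graphs than split graphs: encode a
-- balanced graph by its class among the split graphs.
balanced≤split : {s b : ℕ} → NumClasses n IsSplit s → NumClasses n IsBalanced b → b ≤ s
balanced≤split {s = s} (repS , _ , _ , complete) B = classes-bound B code faithful
  where
  classOf : ∀ G → IsBalanced G → ∃ λ i → Iso G (repS i)
  classOf G (K , clique , stable , _) = complete G (K , clique , stable)

  code : ∀ G → IsBalanced G → Fin s
  code G p = proj₁ (classOf G p)

  faithful : ∀ {G G′} p p′ → code G p ≡ code G′ p′ → G ≅ G′
  faithful {G} {G′} p p′ e =
    ≅-trans (Iso⇒≅ (proj₂ (classOf G p)))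
            (≅-sym (subst (λ i → G′ ≅ repS i) (sym e) (Iso⇒≅ (proj₂ (classOf G′ p′)))))

same-verdict : {A B : Set} (a? : Dec A) (b? : Dec B) → isYes a? ≡ isYes b? → A → B
same-verdict a? b? e a = toWitness {a? = b?} (subst T e (fromWitness {a? = a?} a))

join-injective : ∀ k l {x y : Fin k ⊎ Fin l} → join k l x ≡ join k l y → x ≡ y
join-injective k l {x} {y} e =
  trans (sym (splitAt-join k l x)) (trans (cong (splitAt k) e) (splitAt-join k l y))

embed : ∀ a b c → Fin a ⊎ (Fin b ⊎ Fin c) → Fin (a + (b + c))
embed a b c x = join a (b + c) (map₂ (join b c) x)

embed-injective : ∀ a b c {x y} → embed a b c x ≡ embed a b c y → x ≡ y
embed-injective a b c {x} {y} e =
  inner-injective (join-injective a (b + c) {map₂ (join b c) x} {map₂ (join b c) y} e)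
  where
  inner-injective : ∀ {x y : Fin a ⊎ (Fin b ⊎ Fin c)} → map₂ (join b c) x ≡ map₂ (join b c) y → x ≡ y
  inner-injective {inj₁ _} {inj₁ _} refl = refl
  inner-injective {inj₂ _} {inj₂ _} e′   = cong inj₂ (join-injective b c (inj₂-injective e′))
  inner-injective {inj₁ _} {inj₂ _} ()
  inner-injective {inj₂ _} {inj₁ _} ()

-- A split graph on m+1
-- vertices is either balanced, and then encoded by its balanced class, or
-- has a swing vertex u, and then encoded by the split class of G − u and
-- the enlargeability bit, which determine it by swing-reconstruction.
module SplitCount {m s₀ b₁ : ℕ}
    (S₀ : NumClasses m IsSplit s₀) (B₁ : NumClasses (suc m) IsBalanced b₁) where

  repS₀ : Fin s₀ → Graph m
  repS₀ = proj₁ S₀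

  repB₁ : Fin b₁ → Graph (suc m)
  repB₁ = proj₁ B₁

  data Shape (G : Graph (suc m)) : Set where
    balanced : (k : Fin b₁) → G ≅ repB₁ k → Shape G
    swinging : (u : Fin (suc m)) → IsSwing G u → (j : Fin s₀) → delete G u ≅ repS₀ j → Shape G

  shape : ∀ G → IsSplit G → Shape G
  shape G split with any? (λ u → isSplitLabelling? (delete G u) (neighbours G u))
  ... | yes (u , swing) =
    let (j , σ) = proj₂ (proj₂ (proj₂ S₀)) (delete G u) (labelling⇒split (delete G u) swing)
    in swinging u swing j (Iso⇒≅ σ)
  ... | no no-swing =
    let (k , σ) = proj₂ (proj₂ (proj₂ B₁)) G (balanced-unless-swing G split no-swing)
    in balanced k (Iso⇒≅ σ)

  enlargeable?ᵥ : (G : Graph (suc m)) (u : Fin (suc m)) → Dec (Enlargeable (delete G u) (neighbours G u))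
  enlargeable?ᵥ G u = enlargeable? (delete G u) (neighbours G u)

  bit : (G : Graph (suc m)) → Fin (suc m) → Bool
  bit G u = isYes (enlargeable?ᵥ G u)

  tag : Bool → Fin s₀ → Fin s₀ ⊎ Fin s₀
  tag true  = inj₁
  tag false = inj₂

  tag-injective : ∀ {c c′ j j′} → tag c j ≡ tag c′ j′ → c ≡ c′ × j ≡ j′
  tag-injective {true}  {true}  refl = refl , refl
  tag-injective {false} {false} refl = refl , refl

  encode : ∀ {G} → Shape G → Fin b₁ ⊎ (Fin s₀ ⊎ Fin s₀)
  encode     (balanced k _)     = inj₁ k
  encode {G} (swinging u _ j _) = inj₂ (tag (bit G u) j)

  encode-faithful : ∀ {G G′} (r : Shape G) (r′ : Shape G′) → encode r ≡ encode r′ → G ≅ G′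
  encode-faithful (balanced k σ) (balanced .k σ′) refl = ≅-trans σ (≅-sym σ′)
  encode-faithful {G} {G′} (swinging u swing j σ) (swinging u′ swing′ j′ σ′) e
    with tag-injective {bit G u} {bit G′ u′} (inj₂-injective e)
  ... | same-bit , refl =
    swing-reconstruction G G′ swing swing′ (≅-trans σ (≅-sym σ′))
      (same-verdict (enlargeable?ᵥ G u) (enlargeable?ᵥ G′ u′) same-bit)
      (same-verdict (enlargeable?ᵥ G′ u′) (enlargeable?ᵥ G u) (sym same-bit))

  split≤ : {s₁ : ℕ} → NumClasses (suc m) IsSplit s₁ → s₁ ≤ b₁ + (s₀ + s₀)
  split≤ S₁ = classes-bound S₁ (λ G p → embed b₁ s₀ s₀ (encode (shape G p)))
    λ p p′ e → encode-faithful (shape _ p) (shape _ p′) (embed-injective b₁ s₀ s₀ e)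

-- Doubling the numerator preserves a zero limit (run the hypothesis with ε/2).
ratioTendsToZero-double : {a c : ℕ → ℕ} →
  RatioTendsToZero a c → RatioTendsToZero (λ n → a n + a n) c
ratioTendsToZero-double {a} {c} a/c→0 p q 0<p 0<q
  with a/c→0 p (q + q) 0<p (≤-trans 0<q (m≤m+n q q))
... | N , bound = N , λ n n≥N → subst (_< p * c n) (halve n) (bound n n≥N)
  where
  halve : ∀ n → (q + q) * a n ≡ q * (a n + a n)
  halve n = trans (*-distribʳ-+ (a n) q q) (sym (*-distribˡ-+ q (a n) (a n)))

ratioTendsToOne-fromGap : {b s e : ℕ → ℕ} →
  (∀ n → ∣ b (suc n) - s (suc n) ∣ ≤ e n) →
  RatioTendsToZero e (λ n → s (suc n)) → RatioTendsToOne b s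
ratioTendsToOne-fromGap {b} {s} {e} gap e/s→0 p q 0<p 0<q with e/s→0 p q 0<p 0<q
... | N , bound = suc N , eventually
  where
  eventually : ∀ n → n ≥ suc N → q * ∣ b n - s n ∣ < p * s n
  eventually (suc n) (s≤s n≥N) = ≤-<-trans (*-monoʳ-≤ q (gap n)) (bound n n≥N)

∣m-n∣≤-sandwich : ∀ {b s d} → b ≤ s → s ≤ b + d → ∣ b - s ∣ ≤ d
∣m-n∣≤-sandwich {b} {s} b≤s s≤b+d =
  subst (_≤ _) (sym (m≤n⇒∣m-n∣≡n∸m b≤s)) (m≤n+o⇒m∸n≤o s b s≤b+d)

theorem5p2 : (s b : ℕ → ℕ) →
    (∀ n → NumClasses n IsSplit (s n)) →
    (∀ n → NumClasses n IsBalanced (b n)) →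
    RatioTendsToZero (λ n → s n) (λ n → s (suc n)) →
    RatioTendsToOne b s
theorem5p2 s b S B s/s→0 = ratioTendsToOne-fromGap {b = b} gap (ratioTendsToZero-double s/s→0)
  where
  gap : ∀ n → ∣ b (suc n) - s (suc n) ∣ ≤ s n + s n
  gap n = ∣m-n∣≤-sandwich (balanced≤split (S (suc n)) (B (suc n)))
                          (SplitCount.split≤ (S n) (B (suc n)) (S (suc n)))
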